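{- Let $\Delta\ge 2$ and let $V$ be a vertex set with $|V|=n\ge\Delta+1$; let $a,b,k_1,k_2$ be the nonnegative integers with $n=a(2\Delta-1)+b$, $b(\Delta-1)=k_1(2\Delta-1)+k_2$, $0\le b,k_2\le 2\Delta-2$. Then $\mathfrak{A}(n,\Delta)\neq\emptyset$.
   Context: A collection of graphs on $V$ is a finite family (multiset) of graphs with vertices in $V$. A star $K_{1,\Delta}$ has a center and $\Delta$ leaves. For a collection $\mathcal{S}$ of stars $K_{1,\Delta}$ on $V$: $\mathcal{S}_u$ is the subcollection of stars with center $u$; $C=\{u:\mathcal{S}_u\ne\emptyset\}$, $L=V\setminus C$; $\overrightarrow{D}$ is the digraph on $V$ with arcs $(x,y)$ whenever $xy$ is an edge of some star in $\mathcal{S}_x$; $d^\pm_{\overrightarrow{D}}$ denote out/in-degrees, $\overrightarrow{D}[C]$ the induced subdigraph, $A(\cdot)$ its arc set; $d$-out-regular means all out-degrees equal $d$. $\mathfrak{A}(n,\Delta)$ is the set of collections $\mathcal{S}$ of stars $K_{1,\Delta}$ on $V$ satisfying: (i) if $n\ge 2\Delta-1$ and $k_2<\Delta$: $|\mathcal{S}|=a(\Delta-1)^2+k_1(\Delta-1)$; $|C|=a(\Delta-1)+k_1$; each $u\in C$ is the center of exactly $\Delta-1$ stars of $\mathcal{S}$, all of whose leaves lie in $L$; $d^-_{\overrightarrow{D}}(v)\le\Delta-1$ for all $v\in L$. (ii) if $n\ge 2\Delta-1$ and $k_2>\Delta$: $|\mathcal{S}|=a(\Delta-1)^2+k_1(\Delta-1)+k_2-\Delta$;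 $|C|=a(\Delta-1)+k_1+1$, $|A(\overrightarrow{D}[C])|=2\Delta-1-k_2$; each $u\in C$ is the center of exactly $\Delta-1-d^-_{\overrightarrow{D}}(u)$ stars of $\mathcal{S}$; $d^-_{\overrightarrow{D}}(v)=\Delta-1$ for all $v\in L$. (iii) if $n\ge 2\Delta-1$ and $k_2=\Delta$: $|\mathcal{S}|=a(\Delta-1)^2+k_1(\Delta-1)$ and $\mathcal{S}$ satisfies the conditions of (i) or of (ii). (iv) if $\Delta+1\le n\le 2\Delta-2$: $|\mathcal{S}|=\lfloor (n-1)^2/4\rfloor$; $|C|=\lfloor (n-1)/2\rfloor$ if $n$ is odd, $|C|\in\{\lfloor (n-1)/2\rfloor,\lceil (n-1)/2\rceil\}$ if $n$ is even; $\overrightarrow{D}[C]$ is $(\Delta-|L|)$-out-regular; for each $u\in C$, $\mathcal{S}_u$ consists of $\Delta-1-d^-_{\overrightarrow{D}}(u)$ copies of $K_{1,\Delta}$ and $L$ is contained in the leaf set of each star of $\mathcal{S}_u$. -}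

module Defs where

open import Data.Nat using (ℕ; zero; suc; _+_; _*_; _∸_; _≤_; _<_)
open import Data.Nat.DivMod using (_/_; _%_)
open import Data.Fin using (Fin)
open import Data.Fin.Properties using (_≟_)
open import Data.Fin.Subset using (Subset; _∈_; _∉_; ∣_∣)
open import Data.Fin.Subset.Properties using (_∈?_)
open import Data.List using (List; length; filter; map; allFin)
open import Data.Nat.ListAction using (sum)
open import Data.List.Relation.Unary.Any using (Any; any?)
import Data.List.Membership.Propositional as LM
open import Data.Product using (_×_; _,_)
open import Data.Sum using (_⊎_)
open import Relation.Nullary using (¬_; Dec)
open import Relation.Nullary.Decidable using (_×-dec_; ¬?)
open import Relation.Binary.PropositionalEquality using (_≡_)

record Star (n Δ : ℕ) : Set where
  field
    center    : Fin n
    leaves    : Subset n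
    leavesCard : ∣ leaves ∣ ≡ Δ
    centerNotLeaf : center ∉ leaves
open Star public

-- A collection (multiset) of stars K_{1,Δ} on Fin n.
Collection : ℕ → ℕ → Set
Collection n Δ = List (Star n Δ)

module _ {n Δ : ℕ} (S : Collection n Δ) where

  Sub : Fin n → Collection n Δ
  Sub u = filter (λ s → center s ≟ u) S

  InC : Fin n → Set
  InC u = 0 < length (Sub u)

  InC? : (u : Fin n) → Dec (InC u)
  InC? u = Data.Nat._<?_ 0 (length (Sub u))
    where import Data.Nat

  cardC : ℕ
  cardC = length (filter InC? (allFin n))

  cardL : ℕ
  cardL = length (filter (λ u → ¬? (InC? u)) (allFin n))

  Arc : Fin n → Fin n → Set
  Arc x y = Any (λ s → (center s ≡ x) × (y ∈ leaves s)) S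

  Arc? : (x y : Fin n) → Dec (Arc x y)
  Arc? x y = any? (λ s → (center s ≟ x) ×-dec (y ∈? leaves s)) S

  indeg : Fin n → ℕ
  indeg v = length (filter (λ x → Arc? x v) (allFin n))

  outdegC : Fin n → ℕ
  outdegC x = length (filter (λ y → InC? y ×-dec Arc? x y) (allFin n))

  arcsC : ℕ
  arcsC = sum (map (λ x → length (filter (λ y → (InC? x ×-dec InC? y) ×-dec Arc? x y) (allFin n))) (allFin n))

  CondI : (a k₁ : ℕ) → Set
  CondI a k₁ =
    (length S ≡ a * (Δ ∸ 1) * (Δ ∸ 1) + k₁ * (Δ ∸ 1))
    × (cardC ≡ a * (Δ ∸ 1) + k₁)
    × (∀ u → InC u → length (Sub u) ≡ Δ ∸ 1)
    × (∀ s → s LM.∈ S → ∀ y → y ∈ leaves s → ¬ InC y)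
    × (∀ v → ¬ InC v → indeg v ≤ Δ ∸ 1)

  CondII : (a k₁ k₂ : ℕ) → Set
  CondII a k₁ k₂ =
    (length S ≡ a * (Δ ∸ 1) * (Δ ∸ 1) + k₁ * (Δ ∸ 1) + (k₂ ∸ Δ))
    × (cardC ≡ a * (Δ ∸ 1) + k₁ + 1)
    × (arcsC ≡ 2 * Δ ∸ 1 ∸ k₂)
    × (∀ u → InC u → length (Sub u) + indeg u ≡ Δ ∸ 1)
    × (∀ v → ¬ InC v → indeg v ≡ Δ ∸ 1)

  CondIV : Set
  CondIV =
    (length S ≡ ((n ∸ 1) * (n ∸ 1)) / 4)
    × (n % 2 ≡ 1 → cardC ≡ (n ∸ 1) / 2)
    × (n % 2 ≡ 0 → (cardC ≡ (n ∸ 1) / 2) ⊎ (cardC ≡ n / 2))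
    × (∀ u → InC u → outdegC u + cardL ≡ Δ)
    × (∀ u → InC u → length (Sub u) + indeg u ≡ Δ ∸ 1)
    × (∀ s → s LM.∈ S → ∀ v → ¬ InC v → v ∈ leaves s)

-- membership of S in 𝔄(n, Δ), where a, k₁, k₂ are the parameters
-- determined by n and Δ (see the theorem's hypotheses)
In𝔄 : (n Δ a k₁ k₂ : ℕ) → Collection n Δ → Set
In𝔄 n Δ a k₁ k₂ S =
    (2 * Δ ∸ 1 ≤ n → k₂ < Δ → CondI S a k₁)
  × (2 * Δ ∸ 1 ≤ n → Δ < k₂ → CondII S a k₁ k₂)
  × (2 * Δ ∸ 1 ≤ n → k₂ ≡ Δ →
       (length S ≡ a * (Δ ∸ 1) * (Δ ∸ 1) + k₁ * (Δ ∸ 1))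
       × (CondI S a k₁ ⊎ CondII S a k₁ k₂))
  × (Δ + 1 ≤ n → n ≤ 2 * Δ ∸ 2 → CondIV S)

module Submission where

-- Centres are the vertices 0, …, K − 1 of Fin n; centre x carries several copies of a single
-- star whose leaves are leaf x 0, …, leaf x (Δ − 1), so every condition of 𝔄(n, Δ) becomes
-- arithmetic about the map leaf.
--
-- For n ≥ 2Δ − 1 number the leaf slots of the centres p = xΔ + j. The first N slots are sent
-- cyclically onto the ℓ = n − K other vertices, p ↦ K + p mod ℓ, and the remaining
-- e = KΔ − N < Δ slots, all belonging to the last centre, onto the centres 0, …, e − 1.
-- Since Δ ≤ ℓ no star meets a vertex twice, and the vertex K + w is met exactly by the slots
-- w + rℓ < N, which belong to distinct centres; so its in-degree is at most N / ℓ ≤ Δ − 1, with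
-- equality when N = (Δ − 1)ℓ. Case (i) takes K = a(Δ − 1) + k₁ and e = 0, case (ii) takes
-- K = a(Δ − 1) + k₁ + 1, N = (Δ − 1)ℓ and e = 2Δ − 1 − k₂.
--
-- For Δ + 1 ≤ n ≤ 2Δ − 2 write n − 1 = 2c + t with t ≤ 1 and take c centres, each joined to
-- all ℓ = n − c other vertices and to the next d = Δ − ℓ centres cyclically. This circulant
-- digraph has in- and out-degree d on C, and there are c(Δ − 1 − d) = c(c + t) = ⌊(n − 1)²/4⌋
-- stars.

open import Defs
open import Level using (0ℓ)
open import Algebra.Properties.CommutativeSemigroup using (x∙yz≈y∙xz)
open import Data.Bool using (true; false)
open import Data.Fin using (Fin; toℕ; fromℕ<)
import Data.Fin.Properties as Fin
open import Data.Fin.Subset using (Subset; ∣_∣) renaming (_∈_ to _∈ₛ_)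
open import Data.List using (List; []; _∷_; _++_; length; filter; allFin; map; lookup; tabulate; replicate)
open import Data.List.Properties
  using (map-tabulate; length-++; length-replicate; filter-++; filter-all; filter-none)
open import Data.List.Membership.Propositional using (_∈_; find; lose)
open import Data.List.Membership.Propositional.Properties
  using (∈-filter⁺; ∈-filter⁻; ∈-allFin; ∈-lookup; ∈-++⁺ʳ; ∈-++⁻)
import Data.List.Relation.Unary.All as All
import Data.List.Relation.Unary.All.Properties as All
open import Data.List.Relation.Unary.AllPairs using (_∷_)
open import Data.List.Relation.Unary.Any using (here; index)
open import Data.List.Relation.Unary.Any.Properties using (lookup-index)
open import Data.List.Relation.Unary.Unique.Propositional using (Unique)
import Data.List.Relation.Unary.Unique.Propositional.Properties as Unique
open import Data.Nat
  using (ℕ; zero; suc; pred; _+_; _*_; _∸_; _≤_; _<_; z≤n; s≤s; s≤s⁻¹; z<s; _≟_; _<?_; _≤?_; _/_; _%_;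
         NonZero; >-nonZero; >-nonZero⁻¹)
open import Data.Nat.DivMod
open import Data.Nat.Divisibility using (_∣_; divides; ∣-refl; n∣m*n; ∣m+n∣m⇒∣n; n∣m⇒m%n≡0)
open import Data.Nat.ListAction using (sum)
open import Data.Nat.Properties
open import Data.Nat.Tactic.RingSolver using (solve-∀)
open import Data.Product using (∃; ∃-syntax; _×_; _,_; proj₁; proj₂)
open import Data.Sum using (inj₁; inj₂)
import Data.Vec as Vec
open import Data.Vec.Properties using (lookup∘tabulate; []=⇒lookup; lookup⇒[]=)
open import Function using (_∘_; _∘′_)
open import Relation.Binary.Definitions using (tri<; tri≈; tri>)
open import Relation.Binary.PropositionalEquality
open import Relation.Nullary using (¬_; yes; no; does; contradiction)
open import Relation.Nullary.Decidable using (dec-true; ¬?; _×-dec_)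
open import Relation.Unary using (Pred; Decidable)

-- Sums and counting

sumBelow : ℕ → (ℕ → ℕ) → ℕ
sumBelow zero    f = 0
sumBelow (suc k) f = f k + sumBelow k f

sumBelow-const : ∀ k {f c} → (∀ {i} → i < k → f i ≡ c) → sumBelow k f ≡ k * c
sumBelow-const zero    f≡c = refl
sumBelow-const (suc k) f≡c = cong₂ _+_ (f≡c (n<1+n k)) (sumBelow-const k (f≡c ∘′ m<n⇒m<1+n))

sumBelow-step : ∀ k e {f A B} → e ≤ k → (∀ {i} → i < e → f i ≡ A) → (∀ {i} → e ≤ i → f i ≡ B) →
                sumBelow k f ≡ e * A + (k ∸ e) * B
sumBelow-step zero    zero    _   _     _     = refl
sumBelow-step (suc k) e {f} {A} {B} e≤1+k below above with m≤n⇒m<n∨m≡n e≤1+k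
... | inj₁ e≤k = begin
  f k + sumBelow k f        ≡⟨ cong₂ _+_ (above (s≤s⁻¹ e≤k)) (sumBelow-step k e (s≤s⁻¹ e≤k) below above) ⟩
  B + (e * A + (k ∸ e) * B) ≡⟨ x∙yz≈y∙xz +-commutativeSemigroup B (e * A) _ ⟩
  e * A + suc (k ∸ e) * B   ≡⟨ cong (λ t → e * A + t * B) (+-∸-assoc 1 (s≤s⁻¹ e≤k)) ⟨
  e * A + (suc k ∸ e) * B   ∎
  where open ≡-Reasoning
... | inj₂ refl = begin
  f k + sumBelow k f              ≡⟨ cong₂ _+_ (below (n<1+n k)) (sumBelow-const k (below ∘′ m<n⇒m<1+n)) ⟩
  suc k * A                       ≡⟨ +-identityʳ _ ⟨
  suc k * A + 0                   ≡⟨ cong (λ t → suc k * A + t * B) (n∸n≡0 k) ⟨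
  suc k * A + (suc k ∸ suc k) * B ∎
  where open ≡-Reasoning

sum-tabulate-single : ∀ {n} (f : Fin n → ℕ) u → (∀ w → w ≢ u → f w ≡ 0) → sum (tabulate f) ≡ f u
sum-tabulate-single {suc n} f Fin.zero off = begin
  f Fin.zero + sum (tabulate (f ∘ Fin.suc)) ≡⟨ cong (f Fin.zero +_) (sum-zero (λ w → off (Fin.suc w) λ ())) ⟩
  f Fin.zero + 0                            ≡⟨ +-identityʳ _ ⟩
  f Fin.zero                                ∎
  where
  open ≡-Reasoning
  sum-zero : ∀ {m} {g : Fin m → ℕ} → (∀ w → g w ≡ 0) → sum (tabulate g) ≡ 0
  sum-zero {zero}  g≡0 = refl
  sum-zero {suc m} g≡0 = cong₂ _+_ (g≡0 Fin.zero) (sum-zero (g≡0 ∘ Fin.suc))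
sum-tabulate-single {suc n} f (Fin.suc u) off = cong₂ _+_ (off Fin.zero λ ())
  (sum-tabulate-single (f ∘ Fin.suc) u (λ w w≢u → off (Fin.suc w) (w≢u ∘ Fin.suc-injective)))

sum-allFin-single : ∀ {n} (f : Fin n → ℕ) u → (∀ w → w ≢ u → f w ≡ 0) → sum (map f (allFin n)) ≡ f u
sum-allFin-single {n} f u off =
  trans (cong sum (map-tabulate {n = n} (λ x → x) f)) (sum-tabulate-single f u off)

lookup-injective : ∀ {A : Set} {xs : List A} → Unique xs → ∀ i j → lookup xs i ≡ lookup xs j → i ≡ j
lookup-injective (_ ∷ _)    Fin.zero    Fin.zero    _  = refl
lookup-injective (x∉ ∷ _)   Fin.zero    (Fin.suc j) eq = contradiction eq (All.lookup x∉ (∈-lookup j))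
lookup-injective (x∉ ∷ _)   (Fin.suc i) Fin.zero    eq = contradiction (sym eq) (All.lookup x∉ (∈-lookup i))
lookup-injective (_ ∷ uniq) (Fin.suc i) (Fin.suc j) eq = cong Fin.suc (lookup-injective uniq i j eq)

length-filter-replicate : ∀ {A : Set} {P : Pred A 0ℓ} (P? : Decidable P) m {a} →
                          P a → length (filter P? (replicate m a)) ≡ m
length-filter-replicate P? m pa =
  trans (cong length (filter-all P? (All.replicate⁺ m pa))) (length-replicate m)

length-filter-replicate-¬ : ∀ {A : Set} {P : Pred A 0ℓ} (P? : Decidable P) m {a} →
                            ¬ P a → length (filter P? (replicate m a)) ≡ 0
length-filter-replicate-¬ P? m ¬pa = cong length (filter-none P? (All.replicate⁺ m ¬pa))

∣tabulate∣≡length-filter : ∀ {A : Set} {n} {P : Pred A 0ℓ} (P? : Decidable P) (f : Fin n → A) →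
                            ∣ Vec.tabulate (λ i → does (P? (f i))) ∣ ≡ length (filter P? (tabulate f))
∣tabulate∣≡length-filter {n = zero}  P? f = refl
∣tabulate∣≡length-filter {n = suc n} P? f with does (P? (f Fin.zero))
... | true  = cong suc (∣tabulate∣≡length-filter P? (f ∘ Fin.suc))
... | false = ∣tabulate∣≡length-filter P? (f ∘ Fin.suc)

module _ {n : ℕ} {P : Pred (Fin n) 0ℓ} (P? : Decidable P) where

  count : ℕ
  count = length (filter P? (allFin n))

  private
    xs : List (Fin n)
    xs = filter P? (allFin n)

    xs-unique : Unique xs
    xs-unique = Unique.filter⁺ P? (Unique.allFin⁺ n)

  count-≤ : ∀ m (h : ℕ → ℕ) → (∀ x → P x → ∃[ r ] r < m × h r ≡ toℕ x) → count ≤ m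
  count-≤ m h cover = Fin.injective⇒≤ {f = F} F-injective
    where
    P-lookup : ∀ i → P (lookup xs i)
    P-lookup i = proj₂ (∈-filter⁻ P? {xs = allFin n} (∈-lookup i))

    r : Fin (length xs) → ℕ
    r i = proj₁ (cover _ (P-lookup i))

    r<m : ∀ i → r i < m
    r<m i = proj₁ (proj₂ (cover _ (P-lookup i)))

    h-r : ∀ i → h (r i) ≡ toℕ (lookup xs i)
    h-r i = proj₂ (proj₂ (cover _ (P-lookup i)))

    F : Fin (length xs) → Fin m
    F i = fromℕ< (r<m i)

    F-injective : ∀ {i j} → F i ≡ F j → i ≡ j
    F-injective {i} {j} eq = lookup-injective xs-unique i j (Fin.toℕ-injective (begin
      toℕ (lookup xs i) ≡⟨ h-r i ⟨
      h (r i)           ≡⟨ cong h r-eq ⟩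
      h (r j)           ≡⟨ h-r j ⟩
      toℕ (lookup xs j) ∎))
      where
      open ≡-Reasoning
      r-eq : r i ≡ r j
      r-eq = trans (sym (Fin.toℕ-fromℕ< (r<m i))) (trans (cong toℕ eq) (Fin.toℕ-fromℕ< (r<m j)))

  count-≥ : ∀ m (g : ℕ → ℕ) → (∀ {r} → r < m → ∃[ x ] toℕ x ≡ g r × P x) →
            (∀ {r r'} → r < m → r' < m → g r ≡ g r' → r ≡ r') → m ≤ count
  count-≥ m g pick g-injective = Fin.injective⇒≤ {f = F} F-injective
    where
    x : Fin m → Fin n
    x r = proj₁ (pick (Fin.toℕ<n r))

    toℕ-x : ∀ r → toℕ (x r) ≡ g (toℕ r)
    toℕ-x r = proj₁ (proj₂ (pick (Fin.toℕ<n r)))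

    x∈xs : ∀ r → x r ∈ xs
    x∈xs r = ∈-filter⁺ P? (∈-allFin _) (proj₂ (proj₂ (pick (Fin.toℕ<n r))))

    F : Fin m → Fin (length xs)
    F r = index (x∈xs r)

    F-injective : ∀ {r r'} → F r ≡ F r' → r ≡ r'
    F-injective {r} {r'} eq = Fin.toℕ-injective (g-injective (Fin.toℕ<n r) (Fin.toℕ<n r') (begin
      g (toℕ r)   ≡⟨ toℕ-x r ⟨
      toℕ (x r)   ≡⟨ cong toℕ x-eq ⟩
      toℕ (x r')  ≡⟨ toℕ-x r' ⟩
      g (toℕ r')  ∎))
      where
      open ≡-Reasoning
      x-eq : x r ≡ x r'
      x-eq = trans (lookup-index (x∈xs r)) (trans (cong (lookup xs) eq) (sym (lookup-index (x∈xs r'))))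

  count-initial : ∀ {K} → K ≤ n → (∀ {x} → P x → toℕ x < K) → (∀ {x} → toℕ x < K → P x) →
                  count ≡ K
  count-initial {K} K≤n P⇒<K <K⇒P = ≤-antisym
    (count-≤ K (λ r → r) (λ x px → toℕ x , P⇒<K px , refl))
    (count-≥ K (λ r → r)
      (λ r<K → let r<n = <-≤-trans r<K K≤n in
        fromℕ< r<n , Fin.toℕ-fromℕ< r<n , <K⇒P (subst (_< K) (sym (Fin.toℕ-fromℕ< r<n)) r<K))
      (λ _ _ eq → eq))

  count-final : ∀ {K} → K ≤ n → (∀ {x} → P x → K ≤ toℕ x) → (∀ {x} → K ≤ toℕ x → P x) →
                count ≡ n ∸ K
  count-final {K} K≤n P⇒K≤ K≤⇒P = ≤-antisym
    (count-≤ (n ∸ K) (K +_)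
      (λ x px → toℕ x ∸ K , ∸-monoˡ-< (Fin.toℕ<n x) (P⇒K≤ px) , m+[n∸m]≡n (P⇒K≤ px)))
    (count-≥ (n ∸ K) (K +_)
      (λ {r} r<n∸K → let K+r<n = subst (K + r <_) (m+[n∸m]≡n K≤n) (+-monoʳ-< K r<n∸K) in
        fromℕ< K+r<n , Fin.toℕ-fromℕ< K+r<n ,
        K≤⇒P (subst (K ≤_) (sym (Fin.toℕ-fromℕ< K+r<n)) (m≤m+n K r)))
      (λ _ _ → +-cancelˡ-≡ K _ _))

-- Division with remainder

[m*n+o]/n≡m : ∀ m {n o} .{{_ : NonZero n}} → o < n → (m * n + o) / n ≡ m
[m*n+o]/n≡m m {n} {o} o<n = begin
  (m * n + o) / n   ≡⟨ +-distrib-/-∣ˡ o (n∣m*n m) ⟩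
  m * n / n + o / n ≡⟨ cong₂ _+_ (m*n/n≡m m n) (m<n⇒m/n≡0 o<n) ⟩
  m + 0             ≡⟨ +-identityʳ m ⟩
  m                 ∎
  where open ≡-Reasoning

[m+n]/n≡1+m/n : ∀ m n .{{_ : NonZero n}} → (m + n) / n ≡ suc (m / n)
[m+n]/n≡1+m/n m n = trans (+-distrib-/-∣ʳ m ∣-refl) (trans (cong (m / n +_) (n/n≡1 n)) (+-comm (m / n) 1))

[m+kn]%n≡m : ∀ {m} k {n} .{{_ : NonZero n}} → m < n → (m + k * n) % n ≡ m
[m+kn]%n≡m {m} k {n} m<n = trans ([m+kn]%n≡m%n m k n) (m<n⇒m%n≡m m<n)

[m%n+o]%n≡[m+o]%n : ∀ m o n .{{_ : NonZero n}} → (m % n + o) % n ≡ (m + o) % n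
[m%n+o]%n≡[m+o]%n m o n = begin
  (m % n + o) % n         ≡⟨ %-distribˡ-+ (m % n) o n ⟩
  (m % n % n + o % n) % n ≡⟨ cong (λ z → (z + o % n) % n) (m%n%n≡m%n m n) ⟩
  (m % n + o % n) % n     ≡⟨ %-distribˡ-+ m o n ⟨
  (m + o) % n             ∎
  where open ≡-Reasoning

[m+n]%o≡m%o⇒n≡0 : ∀ m {n o} .{{_ : NonZero o}} → n < o → (m + n) % o ≡ m % o → n ≡ 0
[m+n]%o≡m%o⇒n≡0 m {n} {o} n<o eq = trans (sym (m<n⇒m%n≡m n<o)) (n∣m⇒m%n≡0 n o o∣n)
  where
  open ≡-Reasoning
  o∣n : o ∣ n
  o∣n = ∣m+n∣m⇒∣n (divides ((m + n) / o) (+-cancelˡ-≡ (m % o) _ _ (begin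
    m % o + (m / o * o + n)       ≡⟨ +-assoc (m % o) _ n ⟨
    m % o + m / o * o + n         ≡⟨ cong (_+ n) (m≡m%n+[m/n]*n m o) ⟨
    m + n                         ≡⟨ m≡m%n+[m/n]*n (m + n) o ⟩
    (m + n) % o + (m + n) / o * o ≡⟨ cong (_+ (m + n) / o * o) eq ⟩
    m % o + (m + n) / o * o       ∎))) (n∣m*n (m / o))

private
  +-%-gap : ∀ m {i i' o} .{{_ : NonZero o}} → i ≤ i' → i' < o → (m + i') % o ≡ (m + i) % o → i' ≡ i
  +-%-gap m {i} {i'} {o} i≤i' i'<o eq = begin
    i'           ≡⟨ m+[n∸m]≡n i≤i' ⟨
    i + (i' ∸ i) ≡⟨ cong (i +_) gap≡0 ⟩
    i + 0        ≡⟨ +-identityʳ i ⟩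
    i            ∎
    where
    open ≡-Reasoning
    gap≡0 : i' ∸ i ≡ 0
    gap≡0 = [m+n]%o≡m%o⇒n≡0 (m + i) (≤-<-trans (m∸n≤m i' i) i'<o)
              (trans (cong (_% o) (trans (+-assoc m i (i' ∸ i)) (cong (m +_) (m+[n∸m]≡n i≤i')))) eq)

+-%-injectiveʳ : ∀ m {n n' o} .{{_ : NonZero o}} → n < o → n' < o → (m + n) % o ≡ (m + n') % o → n ≡ n'
+-%-injectiveʳ m {n} {n'} n<o n'<o eq with ≤-total n n'
... | inj₁ n≤n' = sym (+-%-gap m n≤n' n'<o (sym eq))
... | inj₂ n'≤n = +-%-gap m n'≤n n<o eq

-- Collections of stars with prescribed leaves

record StarLayout (n Δ K : ℕ) : Set where
  field
    leaf           : ℕ → ℕ → ℕ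
    leaf<n         : ∀ {x j} → x < K → j < Δ → leaf x j < n
    leaf-injective : ∀ {x j j'} → x < K → j < Δ → j' < Δ → leaf x j ≡ leaf x j' → j ≡ j'
    leaf≢centre    : ∀ {x j} → x < K → j < Δ → leaf x j ≢ x

module StarCollection {n Δ K : ℕ} (K≤n : K ≤ n) (layout : StarLayout n Δ K)
                      (mult : ℕ → ℕ) (mult>0 : ∀ {x} → x < K → 0 < mult x) where
  open StarLayout layout

  IsLeaf : ℕ → Fin n → Set
  IsLeaf x v = ∃ λ (j : Fin Δ) → leaf x (toℕ j) ≡ toℕ v

  isLeaf? : ∀ x → Decidable (IsLeaf x)
  isLeaf? x v = Fin.any? (λ j → leaf x (toℕ j) ≟ toℕ v)

  leafSet : ℕ → Subset n
  leafSet x = Vec.tabulate (λ v → does (isLeaf? x v))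

  ∈leafSet⁻ : ∀ {x v} → v ∈ₛ leafSet x → IsLeaf x v
  ∈leafSet⁻ {x} {v} v∈ with isLeaf? x v | trans (sym (lookup∘tabulate _ v)) ([]=⇒lookup v∈)
  ... | yes isLeaf | _ = isLeaf

  ∈leafSet⁺ : ∀ {x v} → IsLeaf x v → v ∈ₛ leafSet x
  ∈leafSet⁺ {x} {v} isLeaf = lookup⇒[]= v _ (trans (lookup∘tabulate _ v) (dec-true (isLeaf? x v) isLeaf))

  ∣leafSet∣ : ∀ {x} → x < K → ∣ leafSet x ∣ ≡ Δ
  ∣leafSet∣ {x} x<K = trans (∣tabulate∣≡length-filter (isLeaf? x) (λ v → v)) (≤-antisym
    (count-≤ (isLeaf? x) Δ (leaf x) (λ v (j , eq) → toℕ j , Fin.toℕ<n j , eq))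
    (count-≥ (isLeaf? x) Δ (leaf x)
      (λ j<Δ → fromℕ< (leaf<n x<K j<Δ) , Fin.toℕ-fromℕ< _ ,
               fromℕ< j<Δ , trans (cong (leaf x) (Fin.toℕ-fromℕ< j<Δ)) (sym (Fin.toℕ-fromℕ< _)))
      (leaf-injective x<K)))

  centre : ∀ {x} → x < K → Fin n
  centre x<K = fromℕ< (<-≤-trans x<K K≤n)

  toℕ-centre : ∀ {x} (x<K : x < K) → toℕ (centre x<K) ≡ x
  toℕ-centre x<K = Fin.toℕ-fromℕ< (<-≤-trans x<K K≤n)

  star : ∀ {x} → x < K → Star n Δ
  star {x} x<K = record
    { center        = centre x<K
    ; leaves        = leafSet x
    ; leavesCard    = ∣leafSet∣ x<K
    ; centerNotLeaf = λ centre∈ → let j , eq = ∈leafSet⁻ centre∈ in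
                        leaf≢centre x<K (Fin.toℕ<n j) (trans eq (toℕ-centre x<K))
    }

  stars : ∀ k → k ≤ K → Collection n Δ
  stars zero    _   = []
  stars (suc k) k<K = replicate (mult k) (star k<K) ++ stars k (<⇒≤ k<K)

  S : Collection n Δ
  S = stars K ≤-refl

  length-S : length S ≡ sumBelow K mult
  length-S = length-stars K ≤-refl
    where
    length-stars : ∀ k k≤K → length (stars k k≤K) ≡ sumBelow k mult
    length-stars zero    _   = refl
    length-stars (suc k) k<K = trans (length-++ (replicate (mult k) (star k<K)))
                                     (cong₂ _+_ (length-replicate (mult k)) (length-stars k (<⇒≤ k<K)))

  ∈S⇒star : ∀ {s} → s ∈ S → ∃[ x ] ∃ λ (x<K : x < K) → s ≡ star x<K
  ∈S⇒star = ∈stars⇒star K ≤-refl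
    where
    ∈stars⇒star : ∀ k k≤K {s} → s ∈ stars k k≤K → ∃[ x ] ∃ λ (x<K : x < K) → s ≡ star x<K
    ∈stars⇒star (suc k) k<K s∈ with ∈-++⁻ (replicate (mult k) (star k<K)) s∈
    ... | inj₁ s∈block = k , k<K , All.lookup (All.replicate⁺ {P = _≡ star k<K} (mult k) refl) s∈block
    ... | inj₂ s∈rest  = ∈stars⇒star k (<⇒≤ k<K) s∈rest

  star∈S : ∀ {x} (x<K : x < K) → star x<K ∈ S
  star∈S {x} x<K = star∈stars K ≤-refl x<K
    where
    star∈stars : ∀ k k≤K → x < k → star x<K ∈ stars k k≤K
    star∈stars (suc k) k<K x<1+k with m≤n⇒m<n∨m≡n (s≤s⁻¹ x<1+k)
    ... | inj₁ x<k  = ∈-++⁺ʳ (replicate (mult k) (star k<K)) (star∈stars k (<⇒≤ k<K) x<k)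
    ... | inj₂ refl with mult k | mult>0 k<K
    ...   | suc _ | _ = here (cong star (<-irrelevant x<K k<K))

  private
    centredAt? : ∀ u → Decidable (λ (s : Star n Δ) → center s ≡ u)
    centredAt? u s = center s Fin.≟ u

    block : ∀ {k} → k < K → Collection n Δ
    block {k} k<K = replicate (mult k) (star k<K)

    length-filter-stars : ∀ {k} (k<K : k < K) u →
      length (filter (centredAt? u) (stars (suc k) k<K)) ≡
      length (filter (centredAt? u) (block k<K)) + length (filter (centredAt? u) (stars k (<⇒≤ k<K)))
    length-filter-stars k<K u = trans (cong length (filter-++ (centredAt? u) (block k<K) _))
                                      (length-++ (filter (centredAt? u) (block k<K)))

    block-centred : ∀ {k} (k<K : k < K) {u} → toℕ u ≡ k → length (filter (centredAt? u) (block k<K)) ≡ mult k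
    block-centred {k} k<K {u} u≡k = length-filter-replicate (centredAt? u) (mult k)
      (Fin.toℕ-injective (trans (toℕ-centre k<K) (sym u≡k)))

    block-off : ∀ {k} (k<K : k < K) {u} → toℕ u ≢ k → length (filter (centredAt? u) (block k<K)) ≡ 0
    block-off {k} k<K {u} u≢k = length-filter-replicate-¬ (centredAt? u) (mult k)
      (λ centre≡u → u≢k (trans (cong toℕ (sym centre≡u)) (toℕ-centre k<K)))

    length-filter-stars-≥ : ∀ k k≤K u → k ≤ toℕ u → length (filter (centredAt? u) (stars k k≤K)) ≡ 0
    length-filter-stars-≥ zero    _   u _   = refl
    length-filter-stars-≥ (suc k) k<K u k<u = trans (length-filter-stars k<K u)
      (cong₂ _+_ (block-off k<K (>⇒≢ k<u)) (length-filter-stars-≥ k _ u (<⇒≤ k<u)))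

    length-filter-stars-< : ∀ k k≤K u → toℕ u < k →
                            length (filter (centredAt? u) (stars k k≤K)) ≡ mult (toℕ u)
    length-filter-stars-< (suc k) k<K u u<1+k with m≤n⇒m<n∨m≡n (s≤s⁻¹ u<1+k)
    ... | inj₁ u<k  = trans (length-filter-stars k<K u)
      (cong₂ _+_ (block-off k<K (<⇒≢ u<k)) (length-filter-stars-< k _ u u<k))
    ... | inj₂ refl = trans (length-filter-stars k<K u)
      (trans (cong₂ _+_ (block-centred k<K refl) (length-filter-stars-≥ k _ u ≤-refl)) (+-identityʳ _))

  length-Sub : ∀ {u} → toℕ u < K → length (Sub S u) ≡ mult (toℕ u)
  length-Sub {u} = length-filter-stars-< K ≤-refl u

  length-Sub-≥ : ∀ {u} → K ≤ toℕ u → length (Sub S u) ≡ 0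
  length-Sub-≥ {u} = length-filter-stars-≥ K ≤-refl u

  InC⇒<K : ∀ {u} → InC S u → toℕ u < K
  InC⇒<K {u} u∈C with toℕ u <? K
  ... | yes u<K = u<K
  ... | no  u≮K = contradiction (length-Sub-≥ (≮⇒≥ u≮K)) (>⇒≢ u∈C)

  <K⇒InC : ∀ {u} → toℕ u < K → InC S u
  <K⇒InC u<K = subst (0 <_) (sym (length-Sub u<K)) (mult>0 u<K)

  cardC≡K : cardC S ≡ K
  cardC≡K = count-initial (InC? S) K≤n InC⇒<K <K⇒InC

  cardL≡n∸K : cardL S ≡ n ∸ K
  cardL≡n∸K = count-final (λ u → ¬? (InC? S u)) K≤n
    (λ u∉C → ≮⇒≥ (u∉C ∘ <K⇒InC)) (λ K≤u u∈C → <⇒≱ (InC⇒<K u∈C) K≤u)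

  ∈S⇒centre<K : ∀ {s} → s ∈ S → toℕ (center s) < K
  ∈S⇒centre<K s∈S with ∈S⇒star s∈S
  ... | x , x<K , refl = subst (_< K) (sym (toℕ-centre x<K)) x<K

  ∈S⇒leaf : ∀ {s v} → s ∈ S → v ∈ₛ leaves s → IsLeaf (toℕ (center s)) v
  ∈S⇒leaf s∈S v∈ with ∈S⇒star s∈S
  ... | x , x<K , refl = subst (λ z → IsLeaf z _) (sym (toℕ-centre x<K)) (∈leafSet⁻ v∈)

  leaf⇒∈S-leaves : ∀ {s v} → s ∈ S → IsLeaf (toℕ (center s)) v → v ∈ₛ leaves s
  leaf⇒∈S-leaves s∈S isLeaf with ∈S⇒star s∈S
  ... | x , x<K , refl = ∈leafSet⁺ (subst (λ z → IsLeaf z _) (toℕ-centre x<K) isLeaf)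

  Arc⇒ : ∀ {x y} → Arc S x y → toℕ x < K × IsLeaf (toℕ x) y
  Arc⇒ arc with find arc
  ... | s , s∈S , refl , y∈ = ∈S⇒centre<K s∈S , ∈S⇒leaf s∈S y∈

  ⇒Arc : ∀ {x y} → toℕ x < K → IsLeaf (toℕ x) y → Arc S x y
  ⇒Arc {x} x<K isLeaf = lose (star∈S x<K) (Fin.fromℕ<-toℕ x _ , ∈leafSet⁺ isLeaf)

-- The wrap-around construction, for n ≥ 2Δ − 1

module WrapAround {n Δ K ℓ N e : ℕ} (n≡K+ℓ : n ≡ K + ℓ) (2≤Δ : 2 ≤ Δ) (Δ≤ℓ : Δ ≤ ℓ)
                  (N≤[Δ∸1]ℓ : N ≤ (Δ ∸ 1) * ℓ) (KΔ≡N+e : K * Δ ≡ N + e)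
                  (e≤Δ∸2 : e ≤ Δ ∸ 2) (e<K : e < K) where

  private instance
    Δ≢0 : NonZero Δ
    Δ≢0 = >-nonZero (<-≤-trans z<s 2≤Δ)
    ℓ≢0 : NonZero ℓ
    ℓ≢0 = >-nonZero (<-≤-trans z<s (≤-trans 2≤Δ Δ≤ℓ))
    K≢0 : NonZero K
    K≢0 = >-nonZero (≤-<-trans z≤n e<K)

  K≤n : K ≤ n
  K≤n = subst (K ≤_) (sym n≡K+ℓ) (m≤m+n K ℓ)

  e≤Δ : e ≤ Δ
  e≤Δ = ≤-trans e≤Δ∸2 (m∸n≤m Δ 2)

  slotLeaf : ℕ → ℕ
  slotLeaf p with p <? N
  ... | yes _ = K + p % ℓ
  ... | no  _ = p ∸ N

  slotLeaf-< : ∀ {p} → p < N → slotLeaf p ≡ K + p % ℓ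
  slotLeaf-< {p} p<N with p <? N
  ... | yes _   = refl
  ... | no  p≮N = contradiction p<N p≮N

  slotLeaf-≥ : ∀ {p} → N ≤ p → slotLeaf p ≡ p ∸ N
  slotLeaf-≥ {p} N≤p with p <? N
  ... | yes p<N = contradiction N≤p (<⇒≱ p<N)
  ... | no  _   = refl

  K≤slotLeaf : ∀ {p} → p < N → K ≤ slotLeaf p
  K≤slotLeaf p<N = subst (K ≤_) (sym (slotLeaf-< p<N)) (m≤m+n K _)

  slot<KΔ : ∀ {x j} → x < K → j < Δ → x * Δ + j < K * Δ
  slot<KΔ {x} {j} x<K j<Δ = begin-strict
    x * Δ + j <⟨ +-monoʳ-< (x * Δ) j<Δ ⟩
    x * Δ + Δ ≡⟨ +-comm (x * Δ) Δ ⟩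
    suc x * Δ ≤⟨ *-monoˡ-≤ Δ x<K ⟩
    K * Δ     ∎
    where open ≤-Reasoning

  overflow : ∀ {x j} → x < K → j < Δ → N ≤ x * Δ + j → slotLeaf (x * Δ + j) < e × suc x ≡ K
  overflow {x} {j} x<K j<Δ N≤p = slotLeaf<e , ≤-antisym x<K (s≤s⁻¹ (*-cancelʳ-< Δ K (2 + x) KΔ<[2+x]Δ))
    where
    slotLeaf<e : slotLeaf (x * Δ + j) < e
    slotLeaf<e = subst (_< e) (sym (slotLeaf-≥ N≤p)) (subst (x * Δ + j ∸ N <_) (m+n∸m≡n N e)
      (∸-monoˡ-< (subst (x * Δ + j <_) KΔ≡N+e (slot<KΔ x<K j<Δ)) N≤p))

    KΔ<[2+x]Δ : K * Δ < (2 + x) * Δ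
    KΔ<[2+x]Δ = begin-strict
      K * Δ           ≡⟨ KΔ≡N+e ⟩
      N + e           ≤⟨ +-mono-≤ N≤p e≤Δ ⟩
      x * Δ + j + Δ   <⟨ +-monoˡ-< Δ (+-monoʳ-< (x * Δ) j<Δ) ⟩
      x * Δ + Δ + Δ   ≡⟨ +-comm (x * Δ + Δ) Δ ⟩
      Δ + (x * Δ + Δ) ≡⟨ cong (Δ +_) (+-comm (x * Δ) Δ) ⟩
      (2 + x) * Δ     ∎
      where open ≤-Reasoning

  layout : StarLayout n Δ K
  layout = record
    { leaf           = λ x j → slotLeaf (x * Δ + j)
    ; leaf<n         = leaf<n
    ; leaf-injective = leaf-injective
    ; leaf≢centre    = leaf≢centre
    }
    where
    leaf<n : ∀ {x j} → x < K → j < Δ → slotLeaf (x * Δ + j) < n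
    leaf<n {x} {j} x<K j<Δ with <-≤-connex (x * Δ + j) N
    ... | inj₁ p<N = subst₂ _<_ (sym (slotLeaf-< p<N)) (sym n≡K+ℓ) (+-monoʳ-< K (m%n<n _ ℓ))
    ... | inj₂ N≤p = <-≤-trans (proj₁ (overflow x<K j<Δ N≤p)) (≤-trans (<⇒≤ e<K) K≤n)

    leaf-injective : ∀ {x j j'} → x < K → j < Δ → j' < Δ →
                     slotLeaf (x * Δ + j) ≡ slotLeaf (x * Δ + j') → j ≡ j'
    leaf-injective {x} {j} {j'} x<K j<Δ j'<Δ eq with <-≤-connex (x * Δ + j) N | <-≤-connex (x * Δ + j') N
    ... | inj₁ p<N | inj₁ p'<N = +-%-injectiveʳ (x * Δ) (<-≤-trans j<Δ Δ≤ℓ) (<-≤-trans j'<Δ Δ≤ℓ)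
      (+-cancelˡ-≡ K _ _ (trans (sym (slotLeaf-< p<N)) (trans eq (slotLeaf-< p'<N))))
    ... | inj₂ N≤p | inj₂ N≤p' = +-cancelˡ-≡ (x * Δ) _ _
      (∸-cancelʳ-≡ N≤p N≤p' (trans (sym (slotLeaf-≥ N≤p)) (trans eq (slotLeaf-≥ N≤p'))))
    ... | inj₁ p<N | inj₂ N≤p' = contradiction (subst (K ≤_) eq (K≤slotLeaf p<N))
      (<⇒≱ (<-trans (proj₁ (overflow x<K j'<Δ N≤p')) e<K))
    ... | inj₂ N≤p | inj₁ p'<N = contradiction (subst (K ≤_) (sym eq) (K≤slotLeaf p'<N))
      (<⇒≱ (<-trans (proj₁ (overflow x<K j<Δ N≤p)) e<K))

    leaf≢centre : ∀ {x j} → x < K → j < Δ → slotLeaf (x * Δ + j) ≢ x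
    leaf≢centre {x} {j} x<K j<Δ eq with <-≤-connex (x * Δ + j) N
    ... | inj₁ p<N = <⇒≱ x<K (subst (K ≤_) eq (K≤slotLeaf p<N))
    ... | inj₂ N≤p = let leaf<e , 1+x≡K = overflow x<K j<Δ N≤p in
                     <⇒≱ (subst (_< e) eq leaf<e) (s≤s⁻¹ (subst (e <_) (sym 1+x≡K) e<K))

  -- Condition (ii) asks for Δ − 1 − indeg u stars at u, and the centres below e are
  -- exactly those receiving an arc (from the last centre).
  mult : ℕ → ℕ
  mult x with x <? e
  ... | yes _ = Δ ∸ 2
  ... | no  _ = Δ ∸ 1

  mult-< : ∀ {x} → x < e → mult x ≡ Δ ∸ 2
  mult-< {x} x<e with x <? e
  ... | yes _   = refl
  ... | no  x≮e = contradiction x<e x≮e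

  mult-≥ : ∀ {x} → e ≤ x → mult x ≡ Δ ∸ 1
  mult-≥ {x} e≤x with x <? e
  ... | yes x<e = contradiction e≤x (<⇒≱ x<e)
  ... | no  _   = refl

  mult>0 : ∀ {x} → x < K → 0 < mult x
  mult>0 {x} _ with <-≤-connex x e
  ... | inj₁ x<e = subst (0 <_) (sym (mult-< x<e)) (<-≤-trans (≤-<-trans z≤n x<e) e≤Δ∸2)
  ... | inj₂ e≤x = subst (0 <_) (sym (mult-≥ e≤x)) (∸-monoˡ-≤ 1 2≤Δ)

  open StarCollection K≤n layout mult mult>0 public

  length-S≡ : length S ≡ e * (Δ ∸ 2) + (K ∸ e) * (Δ ∸ 1)
  length-S≡ = trans length-S (sumBelow-step K e (<⇒≤ e<K) mult-< mult-≥)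

  arc-into-L : ∀ {x v} → Arc S x v → K ≤ toℕ v →
               toℕ x < K × ∃[ j ] j < Δ × toℕ x * Δ + j < N × K + (toℕ x * Δ + j) % ℓ ≡ toℕ v
  arc-into-L {x} arc K≤v with Arc⇒ arc
  ... | x<K , j , leaf≡v with <-≤-connex (toℕ x * Δ + toℕ j) N
  ...   | inj₁ p<N = x<K , toℕ j , Fin.toℕ<n j , p<N , trans (sym (slotLeaf-< p<N)) leaf≡v
  ...   | inj₂ N≤p = contradiction (subst (K ≤_) (sym leaf≡v) K≤v)
                                   (<⇒≱ (<-trans (proj₁ (overflow x<K (Fin.toℕ<n j) N≤p)) e<K))

  arc-into-C : ∀ {x u} → Arc S x u → toℕ u < K → suc (toℕ x) ≡ K × toℕ u < e
  arc-into-C {x} arc u<K with Arc⇒ arc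
  ... | x<K , j , leaf≡u with <-≤-connex (toℕ x * Δ + toℕ j) N
  ...   | inj₁ p<N = contradiction (subst (K ≤_) leaf≡u (K≤slotLeaf p<N)) (<⇒≱ u<K)
  ...   | inj₂ N≤p = let leaf<e , 1+x≡K = overflow x<K (Fin.toℕ<n j) N≤p in
                     1+x≡K , subst (_< e) leaf≡u leaf<e

  leaf∈C⇒<e : ∀ {s y} → s ∈ S → y ∈ₛ leaves s → InC S y → toℕ y < e
  leaf∈C⇒<e s∈S y∈ y∈C = proj₂ (arc-into-C (lose s∈S (refl , y∈)) (InC⇒<K y∈C))

  private
    pred[K]<K : pred K < K
    pred[K]<K = ≤-reflexive (suc-pred K)

  lastCentre : Fin n
  lastCentre = centre pred[K]<K

  lastCentre<K : toℕ lastCentre < K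
  lastCentre<K = subst (_< K) (sym (toℕ-centre pred[K]<K)) pred[K]<K

  lastCentre-unique : ∀ {x} → suc (toℕ x) ≡ K → x ≡ lastCentre
  lastCentre-unique 1+x≡K = Fin.toℕ-injective (suc-injective (begin
    suc (toℕ _)          ≡⟨ 1+x≡K ⟩
    K                    ≡⟨ suc-pred K ⟨
    suc (pred K)         ≡⟨ cong suc (toℕ-centre pred[K]<K) ⟨
    suc (toℕ lastCentre) ∎))
    where open ≡-Reasoning

  lastCentre-arc : ∀ {y} → toℕ y < e → Arc S lastCentre y
  lastCentre-arc {y} y<e = ⇒Arc lastCentre<K (subst (λ z → IsLeaf z y) (sym (toℕ-centre pred[K]<K)) isLeaf)
    where
    open ≡-Reasoning
    t = toℕ y
    j = Δ ∸ e + t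

    j<Δ : j < Δ
    j<Δ = subst (j <_) (m∸n+n≡m e≤Δ) (+-monoʳ-< (Δ ∸ e) y<e)

    slot≡N+t : pred K * Δ + j ≡ N + t
    slot≡N+t = begin
      pred K * Δ + (Δ ∸ e + t) ≡⟨ +-assoc (pred K * Δ) (Δ ∸ e) t ⟨
      pred K * Δ + (Δ ∸ e) + t ≡⟨ cong (_+ t) (+-∸-assoc (pred K * Δ) e≤Δ) ⟨
      pred K * Δ + Δ ∸ e + t   ≡⟨ cong (λ z → z ∸ e + t) (+-comm (pred K * Δ) Δ) ⟩
      suc (pred K) * Δ ∸ e + t ≡⟨ cong (λ z → z * Δ ∸ e + t) (suc-pred K) ⟩
      K * Δ ∸ e + t            ≡⟨ cong (λ z → z ∸ e + t) KΔ≡N+e ⟩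
      N + e ∸ e + t            ≡⟨ cong (_+ t) (m+n∸n≡m N e) ⟩
      N + t                    ∎

    isLeaf : IsLeaf (pred K) y
    isLeaf = fromℕ< j<Δ , (begin
      slotLeaf (pred K * Δ + toℕ (fromℕ< j<Δ)) ≡⟨ cong (λ i → slotLeaf (pred K * Δ + i)) (Fin.toℕ-fromℕ< _) ⟩
      slotLeaf (pred K * Δ + j)                ≡⟨ cong slotLeaf slot≡N+t ⟩
      slotLeaf (N + t)                         ≡⟨ slotLeaf-≥ (m≤m+n N t) ⟩
      N + t ∸ N                                ≡⟨ m+n∸m≡n N t ⟩
      t                                        ∎)

  indeg-C<e : ∀ {u} → toℕ u < e → indeg S u ≡ 1
  indeg-C<e {u} u<e = ≤-antisym
    (count-≤ (λ x → Arc? S x u) 1 (λ _ → toℕ lastCentre)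
      (λ x arc → 0 , z<s , cong toℕ (sym (lastCentre-unique (proj₁ (arc-into-C arc (<-trans u<e e<K)))))))
    (count-≥ (λ x → Arc? S x u) 1 (λ _ → toℕ lastCentre) (λ _ → lastCentre , refl , lastCentre-arc u<e)
      (λ { z<s z<s _ → refl }))

  indeg-C≥e : ∀ {u} → toℕ u < K → e ≤ toℕ u → indeg S u ≡ 0
  indeg-C≥e {u} u<K e≤u = n≤0⇒n≡0 (count-≤ (λ x → Arc? S x u) 0 (λ r → r)
    (λ x arc → contradiction (proj₂ (arc-into-C arc u<K)) (≤⇒≯ e≤u)))

  length-Sub+indeg : ∀ {u} → InC S u → length (Sub S u) + indeg S u ≡ Δ ∸ 1
  length-Sub+indeg {u} u∈C with <-≤-connex (toℕ u) e
  ... | inj₁ u<e = begin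
    length (Sub S u) + indeg S u ≡⟨ cong₂ _+_ (trans (length-Sub (InC⇒<K u∈C)) (mult-< u<e)) (indeg-C<e u<e) ⟩
    Δ ∸ 2 + 1                    ≡⟨ +-comm (Δ ∸ 2) 1 ⟩
    suc (Δ ∸ 2)                  ≡⟨ +-∸-assoc 1 2≤Δ ⟨
    Δ ∸ 1                        ∎
    where open ≡-Reasoning
  ... | inj₂ e≤u = begin
    length (Sub S u) + indeg S u ≡⟨ cong₂ _+_ (trans (length-Sub u<K) (mult-≥ e≤u)) (indeg-C≥e u<K e≤u) ⟩
    Δ ∸ 1 + 0                    ≡⟨ +-identityʳ _ ⟩
    Δ ∸ 1                        ∎
    where
    open ≡-Reasoning
    u<K = InC⇒<K u∈C

  arcsC≡e : arcsC S ≡ e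
  arcsC≡e = trans (sum-allFin-single (λ x → count (arcInC? x)) lastCentre off) on
    where
    arcInC? : ∀ x → Decidable (λ y → (InC S x × InC S y) × Arc S x y)
    arcInC? x y = (InC? S x ×-dec InC? S y) ×-dec Arc? S x y

    off : ∀ x → x ≢ lastCentre → count (arcInC? x) ≡ 0
    off x x≢last = n≤0⇒n≡0 (count-≤ (arcInC? x) 0 (λ r → r) (λ y ((_ , y∈C) , arc) →
      contradiction (lastCentre-unique (proj₁ (arc-into-C arc (InC⇒<K y∈C)))) x≢last))

    on : count (arcInC? lastCentre) ≡ e
    on = ≤-antisym
      (count-≤ (arcInC? lastCentre) e (λ r → r)
        (λ y ((_ , y∈C) , arc) → toℕ y , proj₂ (arc-into-C arc (InC⇒<K y∈C)) , refl))
      (count-≥ (arcInC? lastCentre) e (λ r → r)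
        (λ r<e → let r<K = <-trans r<e e<K in
          centre r<K , toℕ-centre r<K ,
          (<K⇒InC lastCentre<K , <K⇒InC (subst (_< K) (sym (toℕ-centre r<K)) r<K)) ,
          lastCentre-arc (subst (_< e) (sym (toℕ-centre r<K)) r<e))
        (λ _ _ eq → eq))

  private
    -- The centre owning slot w + rℓ; for w < ℓ this slot, if below N, is sent to the vertex K + w.
    hitCentre : ℕ → ℕ → ℕ
    hitCentre w r = (w + r * ℓ) / Δ

    hitCentre-< : ∀ w {r r'} → r < r' → hitCentre w r < hitCentre w r'
    hitCentre-< w {r} {r'} r<r' = begin-strict
      (w + r * ℓ) / Δ       <⟨ n<1+n _ ⟩
      suc ((w + r * ℓ) / Δ) ≡⟨ [m+n]/n≡1+m/n (w + r * ℓ) Δ ⟨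
      (w + r * ℓ + Δ) / Δ   ≤⟨ /-monoˡ-≤ Δ (+-monoʳ-≤ (w + r * ℓ) Δ≤ℓ) ⟩
      (w + r * ℓ + ℓ) / Δ   ≡⟨ cong (_/ Δ) (+-assoc w (r * ℓ) ℓ) ⟩
      (w + (r * ℓ + ℓ)) / Δ ≡⟨ cong (λ z → (w + z) / Δ) (+-comm (r * ℓ) ℓ) ⟩
      (w + suc r * ℓ) / Δ   ≤⟨ /-monoˡ-≤ Δ (+-monoʳ-≤ w (*-monoˡ-≤ ℓ r<r')) ⟩
      (w + r' * ℓ) / Δ      ∎
      where open ≤-Reasoning

    hitCentre-injective : ∀ w {r r'} → hitCentre w r ≡ hitCentre w r' → r ≡ r'
    hitCentre-injective w {r} {r'} eq with <-cmp r r'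
    ... | tri< r<r' _ _ = contradiction eq (<⇒≢ (hitCentre-< w r<r'))
    ... | tri≈ _ r≡r' _ = r≡r'
    ... | tri> _ _ r'<r = contradiction eq (>⇒≢ (hitCentre-< w r'<r))

  indeg-L≤ : ∀ {v} → K ≤ toℕ v → indeg S v ≤ Δ ∸ 1
  indeg-L≤ {v} K≤v = count-≤ (λ x → Arc? S x v) (Δ ∸ 1) (hitCentre (toℕ v ∸ K)) cover
    where
    cover : ∀ x → Arc S x v → ∃[ r ] r < Δ ∸ 1 × hitCentre (toℕ v ∸ K) r ≡ toℕ x
    cover x arc with arc-into-L arc K≤v
    ... | _ , j , j<Δ , p<N , K+p%ℓ≡v = p / ℓ , m<n*o⇒m/o<n (<-≤-trans p<N N≤[Δ∸1]ℓ) , (begin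
      (toℕ v ∸ K + p / ℓ * ℓ) / Δ ≡⟨ cong (λ w → (w + p / ℓ * ℓ) / Δ) w≡p%ℓ ⟩
      (p % ℓ + p / ℓ * ℓ) / Δ     ≡⟨ cong (_/ Δ) (m≡m%n+[m/n]*n p ℓ) ⟨
      p / Δ                       ≡⟨ [m*n+o]/n≡m (toℕ x) j<Δ ⟩
      toℕ x                       ∎)
      where
      open ≡-Reasoning
      p = toℕ x * Δ + j
      w≡p%ℓ : toℕ v ∸ K ≡ p % ℓ
      w≡p%ℓ = trans (cong (_∸ K) (sym K+p%ℓ≡v)) (m+n∸m≡n K (p % ℓ))

  indeg-L≥ : N ≡ (Δ ∸ 1) * ℓ → ∀ {v} → K ≤ toℕ v → Δ ∸ 1 ≤ indeg S v
  indeg-L≥ N≡[Δ∸1]ℓ {v} K≤v =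
    count-≥ (λ x → Arc? S x v) (Δ ∸ 1) (hitCentre w) hit (λ _ _ → hitCentre-injective w)
    where
    w = toℕ v ∸ K

    w<ℓ : w < ℓ
    w<ℓ = subst (w <_) (m+n∸m≡n K ℓ) (∸-monoˡ-< (subst (toℕ v <_) n≡K+ℓ (Fin.toℕ<n v)) K≤v)

    hit : ∀ {r} → r < Δ ∸ 1 → ∃[ x ] toℕ x ≡ hitCentre w r × Arc S x v
    hit {r} r<Δ∸1 = centre x<K , toℕ-centre x<K ,
      ⇒Arc (subst (_< K) (sym (toℕ-centre x<K)) x<K) (subst (λ z → IsLeaf z v) (sym (toℕ-centre x<K)) isLeaf)
      where
      open ≡-Reasoning
      p = w + r * ℓ
      x = p / Δ

      p<N : p < N
      p<N = subst (p <_) (sym N≡[Δ∸1]ℓ) (<-≤-trans (+-monoˡ-< (r * ℓ) w<ℓ) (*-monoˡ-≤ ℓ r<Δ∸1))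

      x<K : x < K
      x<K = m<n*o⇒m/o<n (<-≤-trans p<N (subst (N ≤_) (sym KΔ≡N+e) (m≤m+n N e)))

      j<Δ : p % Δ < Δ
      j<Δ = m%n<n p Δ

      isLeaf : IsLeaf x v
      isLeaf = fromℕ< j<Δ , (begin
        slotLeaf (x * Δ + toℕ (fromℕ< j<Δ)) ≡⟨ cong (λ j → slotLeaf (x * Δ + j)) (Fin.toℕ-fromℕ< _) ⟩
        slotLeaf (x * Δ + p % Δ)            ≡⟨ cong slotLeaf (+-comm (x * Δ) (p % Δ)) ⟩
        slotLeaf (p % Δ + x * Δ)            ≡⟨ cong slotLeaf (m≡m%n+[m/n]*n p Δ) ⟨
        slotLeaf p                          ≡⟨ slotLeaf-< p<N ⟩
        K + p % ℓ                           ≡⟨ cong (K +_) ([m+kn]%n≡m r w<ℓ) ⟩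
        K + w                               ≡⟨ m+[n∸m]≡n K≤v ⟩
        toℕ v                               ∎)

-- The circulant construction, for Δ + 1 ≤ n ≤ 2Δ − 2

module Circulant {n Δ c ℓ d : ℕ} (n≡c+ℓ : n ≡ c + ℓ) (Δ≡ℓ+d : Δ ≡ ℓ + d) (d<c : d < c)
                 (0<Δ∸1∸d : 0 < Δ ∸ 1 ∸ d) where

  private instance
    c≢0 : NonZero c
    c≢0 = >-nonZero (≤-<-trans z≤n d<c)

  c≤n : c ≤ n
  c≤n = subst (c ≤_) (sym n≡c+ℓ) (m≤m+n c ℓ)

  successor : ℕ → ℕ → ℕ
  successor x t = (suc x + t) % c

  leafOf : ℕ → ℕ → ℕ
  leafOf x j with j <? ℓ
  ... | yes _ = c + j
  ... | no  _ = successor x (j ∸ ℓ)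

  leafOf-< : ∀ {x j} → j < ℓ → leafOf x j ≡ c + j
  leafOf-< {x} {j} j<ℓ with j <? ℓ
  ... | yes _   = refl
  ... | no  j≮ℓ = contradiction j<ℓ j≮ℓ

  leafOf-≥ : ∀ {x j} → ℓ ≤ j → leafOf x j ≡ successor x (j ∸ ℓ)
  leafOf-≥ {x} {j} ℓ≤j with j <? ℓ
  ... | yes j<ℓ = contradiction ℓ≤j (<⇒≱ j<ℓ)
  ... | no  _   = refl

  j∸ℓ<d : ∀ {j} → j < Δ → ℓ ≤ j → j ∸ ℓ < d
  j∸ℓ<d {j} j<Δ ℓ≤j = subst (j ∸ ℓ <_) (m+n∸m≡n ℓ d) (∸-monoˡ-< (subst (j <_) Δ≡ℓ+d j<Δ) ℓ≤j)

  successor-injective : ∀ x {t t'} → t < d → t' < d → successor x t ≡ successor x t' → t ≡ t'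
  successor-injective x t<d t'<d = +-%-injectiveʳ (suc x) (<-trans t<d d<c) (<-trans t'<d d<c)

  layout : StarLayout n Δ c
  layout = record
    { leaf           = leafOf
    ; leaf<n         = leaf<n
    ; leaf-injective = leaf-injective
    ; leaf≢centre    = leaf≢centre
    }
    where
    c≤leafOf : ∀ {x j} → j < ℓ → c ≤ leafOf x j
    c≤leafOf j<ℓ = subst (c ≤_) (sym (leafOf-< j<ℓ)) (m≤m+n c _)

    leafOf<c : ∀ {x j} → ℓ ≤ j → leafOf x j < c
    leafOf<c {x} {j} ℓ≤j = subst (_< c) (sym (leafOf-≥ ℓ≤j)) (m%n<n (suc x + (j ∸ ℓ)) c)

    leaf<n : ∀ {x j} → x < c → j < Δ → leafOf x j < n
    leaf<n {x} {j} _ _ with <-≤-connex j ℓ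
    ... | inj₁ j<ℓ = subst₂ _<_ (sym (leafOf-< j<ℓ)) (sym n≡c+ℓ) (+-monoʳ-< c j<ℓ)
    ... | inj₂ ℓ≤j = <-≤-trans (leafOf<c ℓ≤j) c≤n

    leaf-injective : ∀ {x j j'} → x < c → j < Δ → j' < Δ → leafOf x j ≡ leafOf x j' → j ≡ j'
    leaf-injective {x} {j} {j'} _ j<Δ j'<Δ eq with <-≤-connex j ℓ | <-≤-connex j' ℓ
    ... | inj₁ j<ℓ | inj₁ j'<ℓ =
      +-cancelˡ-≡ c _ _ (trans (sym (leafOf-< j<ℓ)) (trans eq (leafOf-< j'<ℓ)))
    ... | inj₂ ℓ≤j | inj₂ ℓ≤j' = ∸-cancelʳ-≡ ℓ≤j ℓ≤j'
      (successor-injective x (j∸ℓ<d j<Δ ℓ≤j) (j∸ℓ<d j'<Δ ℓ≤j')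
        (trans (sym (leafOf-≥ ℓ≤j)) (trans eq (leafOf-≥ ℓ≤j'))))
    ... | inj₁ j<ℓ | inj₂ ℓ≤j' =
      contradiction (subst (c ≤_) eq (c≤leafOf j<ℓ)) (<⇒≱ (leafOf<c ℓ≤j'))
    ... | inj₂ ℓ≤j | inj₁ j'<ℓ =
      contradiction (subst (c ≤_) (sym eq) (c≤leafOf j'<ℓ)) (<⇒≱ (leafOf<c ℓ≤j))

    leaf≢centre : ∀ {x j} → x < c → j < Δ → leafOf x j ≢ x
    leaf≢centre {x} {j} x<c j<Δ eq with <-≤-connex j ℓ
    ... | inj₁ j<ℓ = <⇒≱ x<c (subst (c ≤_) eq (c≤leafOf j<ℓ))
    ... | inj₂ ℓ≤j = 1+n≢0 (+-%-injectiveʳ x (≤-trans (s≤s (j∸ℓ<d j<Δ ℓ≤j)) d<c) (≤-<-trans z≤n d<c) (begin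
      (x + suc (j ∸ ℓ)) % c ≡⟨ cong (_% c) (+-suc x (j ∸ ℓ)) ⟩
      successor x (j ∸ ℓ)   ≡⟨ leafOf-≥ ℓ≤j ⟨
      leafOf x j            ≡⟨ eq ⟩
      x                     ≡⟨ m<n⇒m%n≡m x<c ⟨
      x % c                 ≡⟨ cong (_% c) (+-identityʳ x) ⟨
      (x + 0) % c           ∎))
      where open ≡-Reasoning

  open StarCollection c≤n layout (λ _ → Δ ∸ 1 ∸ d) (λ _ → 0<Δ∸1∸d) public

  length-S≡ : length S ≡ c * (Δ ∸ 1 ∸ d)
  length-S≡ = trans length-S (sumBelow-const c (λ _ → refl))

  L⊆leaves : ∀ {s v} → s ∈ S → c ≤ toℕ v → v ∈ₛ leaves s
  L⊆leaves {s} {v} s∈S c≤v = leaf⇒∈S-leaves s∈S (fromℕ< j<Δ , (begin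
    leafOf _ (toℕ (fromℕ< j<Δ)) ≡⟨ cong (leafOf _) (Fin.toℕ-fromℕ< j<Δ) ⟩
    leafOf _ j                  ≡⟨ leafOf-< j<ℓ ⟩
    c + (toℕ v ∸ c)             ≡⟨ m+[n∸m]≡n c≤v ⟩
    toℕ v                       ∎))
    where
    open ≡-Reasoning
    j = toℕ v ∸ c

    j<ℓ : j < ℓ
    j<ℓ = subst (j <_) (m+n∸m≡n c ℓ) (∸-monoˡ-< (subst (toℕ v <_) n≡c+ℓ (Fin.toℕ<n v)) c≤v)

    j<Δ : j < Δ
    j<Δ = subst (j <_) (sym Δ≡ℓ+d) (<-≤-trans j<ℓ (m≤m+n ℓ d))

  arc-within-C : ∀ {x y} → Arc S x y → toℕ y < c →
                 toℕ x < c × ∃[ t ] t < d × successor (toℕ x) t ≡ toℕ y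
  arc-within-C arc y<c with Arc⇒ arc
  ... | x<c , j , leaf≡y with <-≤-connex (toℕ j) ℓ
  ...   | inj₁ j<ℓ =
    contradiction (subst (c ≤_) (trans (sym (leafOf-< j<ℓ)) leaf≡y) (m≤m+n c _)) (<⇒≱ y<c)
  ...   | inj₂ ℓ≤j = x<c , toℕ j ∸ ℓ , j∸ℓ<d (Fin.toℕ<n j) ℓ≤j , trans (sym (leafOf-≥ ℓ≤j)) leaf≡y

  successor-isLeaf : ∀ {x y t} → t < d → successor x t ≡ toℕ y → IsLeaf x y
  successor-isLeaf {x} {y} {t} t<d eq = fromℕ< ℓ+t<Δ , (begin
    leafOf x (toℕ (fromℕ< ℓ+t<Δ)) ≡⟨ cong (leafOf x) (Fin.toℕ-fromℕ< ℓ+t<Δ) ⟩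
    leafOf x (ℓ + t)              ≡⟨ leafOf-≥ (m≤m+n ℓ t) ⟩
    successor x (ℓ + t ∸ ℓ)       ≡⟨ cong (successor x) (m+n∸m≡n ℓ t) ⟩
    successor x t                 ≡⟨ eq ⟩
    toℕ y                         ∎)
    where
    open ≡-Reasoning
    ℓ+t<Δ : ℓ + t < Δ
    ℓ+t<Δ = subst (ℓ + t <_) (sym Δ≡ℓ+d) (+-monoʳ-< ℓ t<d)

  private
    predecessor : ℕ → ℕ → ℕ
    predecessor u t = (u + (c ∸ suc t)) % c

    1+t≤c : ∀ {t} → t < d → suc t ≤ c
    1+t≤c t<d = <⇒≤ (≤-<-trans t<d d<c)

    successor-predecessor : ∀ {u t} → u < c → t < d → successor (predecessor u t) t ≡ u
    successor-predecessor {u} {t} u<c t<d = begin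
      (suc (predecessor u t) + t) % c     ≡⟨ cong (_% c) (+-suc (predecessor u t) t) ⟨
      ((u + (c ∸ suc t)) % c + suc t) % c ≡⟨ [m%n+o]%n≡[m+o]%n (u + (c ∸ suc t)) (suc t) c ⟩
      (u + (c ∸ suc t) + suc t) % c       ≡⟨ cong (_% c) (+-assoc u _ (suc t)) ⟩
      (u + (c ∸ suc t + suc t)) % c       ≡⟨ cong (λ z → (u + z) % c) (m∸n+n≡m (1+t≤c t<d)) ⟩
      (u + c) % c                         ≡⟨ [m+n]%n≡m%n u c ⟩
      u % c                               ≡⟨ m<n⇒m%n≡m u<c ⟩
      u                                   ∎
      where open ≡-Reasoning

    predecessor-successor : ∀ {x t} → x < c → t < d → predecessor (successor x t) t ≡ x
    predecessor-successor {x} {t} x<c t<d = begin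
      ((suc x + t) % c + (c ∸ suc t)) % c ≡⟨ [m%n+o]%n≡[m+o]%n (suc x + t) (c ∸ suc t) c ⟩
      (suc x + t + (c ∸ suc t)) % c       ≡⟨ cong (λ z → (z + (c ∸ suc t)) % c) (+-suc x t) ⟨
      (x + suc t + (c ∸ suc t)) % c       ≡⟨ cong (_% c) (+-assoc x (suc t) _) ⟩
      (x + (suc t + (c ∸ suc t))) % c     ≡⟨ cong (λ z → (x + z) % c) (m+[n∸m]≡n (1+t≤c t<d)) ⟩
      (x + c) % c                         ≡⟨ [m+n]%n≡m%n x c ⟩
      x % c                               ≡⟨ m<n⇒m%n≡m x<c ⟩
      x                                   ∎
      where open ≡-Reasoning

  outdegC≡d : ∀ {u} → toℕ u < c → outdegC S u ≡ d
  outdegC≡d {u} u<c = ≤-antisym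
    (count-≤ out? d (successor (toℕ u))
      (λ y (y∈C , arc) → let _ , t , t<d , eq = arc-within-C arc (InC⇒<K y∈C) in t , t<d , eq))
    (count-≥ out? d (successor (toℕ u))
      (λ {t} t<d → let y<c = m%n<n (suc (toℕ u) + t) c in
        centre y<c , toℕ-centre y<c , <K⇒InC (subst (_< c) (sym (toℕ-centre y<c)) y<c) ,
        ⇒Arc u<c (successor-isLeaf t<d (sym (toℕ-centre y<c))))
      (successor-injective (toℕ u)))
    where
    out? : Decidable (λ y → InC S y × Arc S u y)
    out? y = InC? S y ×-dec Arc? S u y

  indeg≡d : ∀ {u} → toℕ u < c → indeg S u ≡ d
  indeg≡d {u} u<c = ≤-antisym
    (count-≤ (λ x → Arc? S x u) d (predecessor (toℕ u))
      (λ x arc → let x<c , t , t<d , eq = arc-within-C arc u<c in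
        t , t<d , trans (cong (λ z → predecessor z t) (sym eq)) (predecessor-successor x<c t<d)))
    (count-≥ (λ x → Arc? S x u) d (predecessor (toℕ u))
      (λ {t} t<d → let x<c = m%n<n (toℕ u + (c ∸ suc t)) c in
        centre x<c , toℕ-centre x<c ,
        ⇒Arc (subst (_< c) (sym (toℕ-centre x<c)) x<c) (subst (λ z → IsLeaf z u) (sym (toℕ-centre x<c))
          (successor-isLeaf t<d (successor-predecessor u<c t<d))))
      (λ {t} {t'} t<d t'<d eq → successor-injective (predecessor (toℕ u) t) t<d t'<d (begin
        successor (predecessor (toℕ u) t) t   ≡⟨ successor-predecessor u<c t<d ⟩
        toℕ u                                 ≡⟨ successor-predecessor u<c t'<d ⟨
        successor (predecessor (toℕ u) t') t' ≡⟨ cong (λ z → successor z t') eq ⟨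
        successor (predecessor (toℕ u) t) t'  ∎)))
    where open ≡-Reasoning

-- Choosing the parameters

2*[1+n]∸1≡1+n+n : ∀ n → 2 * suc n ∸ 1 ≡ suc (n + n)
2*[1+n]∸1≡1+n+n n = trans (cong (n +_) (+-identityʳ (suc n))) (+-suc n n)

2*[1+n]∸2≡n+n : ∀ n → 2 * suc n ∸ 2 ≡ n + n
2*[1+n]∸2≡n+n n = cong (_∸ 1) (2*[1+n]∸1≡1+n+n n)

-- Writing b = k₁ + β, the hypothesis b(Δ − 1) = k₁(2Δ − 1) + k₂ becomes β(Δ − 1) = k₁Δ + k₂.
record WrapParameters (D n a k₁ k₂ : ℕ) : Set where
  field
    β   : ℕ
    1≤a : 1 ≤ a
    n≡  : n ≡ a * suc (D + D) + (k₁ + β)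
    βD≡ : β * D ≡ k₁ * suc D + k₂

wrapParameters : ∀ {D n a b k₁ k₂} .{{_ : NonZero D}} →
                 2 * suc D ∸ 1 ≤ n → n ≡ a * (2 * suc D ∸ 1) + b → b * D ≡ k₁ * (2 * suc D ∸ 1) + k₂ →
                 b ≤ 2 * suc D ∸ 2 → WrapParameters D n a k₁ k₂
wrapParameters {D} {n} {a} {b} {k₁} {k₂} 2D+1≤n n≡ab bD≡ b≤2D = record
  { β   = b ∸ k₁
  ; 1≤a = positive a n≡ab'
  ; n≡  = trans n≡ab' (cong (a * suc (D + D) +_) (sym (m+[n∸m]≡n k₁≤b)))
  ; βD≡ = βD≡
  }
  where
  n≡ab' : n ≡ a * suc (D + D) + b
  n≡ab' = subst (λ z → n ≡ a * z + b) (2*[1+n]∸1≡1+n+n D) n≡ab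

  bD≡' : b * D ≡ k₁ * suc (D + D) + k₂
  bD≡' = subst (λ z → b * D ≡ k₁ * z + k₂) (2*[1+n]∸1≡1+n+n D) bD≡

  positive : ∀ a → n ≡ a * suc (D + D) + b → 1 ≤ a
  positive zero    n≡b = contradiction (subst (_≤ D + D) (sym n≡b) (subst (b ≤_) (2*[1+n]∸2≡n+n D) b≤2D))
                                       (<⇒≱ (subst (_≤ n) (2*[1+n]∸1≡1+n+n D) 2D+1≤n))
  positive (suc _) _   = s≤s z≤n

  k₁≤b : k₁ ≤ b
  k₁≤b = *-cancelʳ-≤ k₁ b D (begin
    k₁ * D                ≤⟨ *-monoʳ-≤ k₁ (≤-trans (m≤m+n D D) (n≤1+n _)) ⟩
    k₁ * suc (D + D)      ≤⟨ m≤m+n _ k₂ ⟩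
    k₁ * suc (D + D) + k₂ ≡⟨ bD≡' ⟨
    b * D                 ∎)
    where open ≤-Reasoning

  βD≡ : (b ∸ k₁) * D ≡ k₁ * suc D + k₂
  βD≡ = +-cancelˡ-≡ (k₁ * D) _ _ (begin
    k₁ * D + (b ∸ k₁) * D      ≡⟨ *-distribʳ-+ D k₁ (b ∸ k₁) ⟨
    (k₁ + (b ∸ k₁)) * D        ≡⟨ cong (_* D) (m+[n∸m]≡n k₁≤b) ⟩
    b * D                      ≡⟨ bD≡' ⟩
    k₁ * suc (D + D) + k₂      ≡⟨ regroup k₁ D k₂ ⟩
    k₁ * D + (k₁ * suc D + k₂) ∎)
    where
    open ≡-Reasoning
    regroup : ∀ k D r → k * suc (D + D) + r ≡ k * D + (k * suc D + r)
    regroup = solve-∀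

wrap-CondI : ∀ {D n a k₁ k₂} .{{_ : NonZero D}} → WrapParameters D n a k₁ k₂ →
             ∃ λ (S : Collection n (suc D)) → CondI S a k₁
wrap-CondI {D} {n} {a} {k₁} {k₂} params =
  S , trans length-S≡ (*-distribʳ-+ D (a * D) k₁) , cardC≡K ,
  (λ u u∈C → trans (length-Sub (InC⇒<K u∈C)) (mult-≥ {toℕ u} z≤n)) ,
  (λ s s∈S y y∈ y∈C → contradiction (leaf∈C⇒<e s∈S y∈ y∈C) λ ()) ,
  (λ v v∉C → indeg-L≤ (≮⇒≥ (v∉C ∘ <K⇒InC)))
  where
  open WrapParameters params
  K = a * D + k₁
  ℓ = a * suc D + β

  n≡K+ℓ : n ≡ K + ℓ
  n≡K+ℓ = trans n≡ (regroup a D k₁ β)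
    where
    regroup : ∀ a D k β → a * suc (D + D) + (k + β) ≡ a * D + k + (a * suc D + β)
    regroup = solve-∀

  1+D≤ℓ : suc D ≤ ℓ
  1+D≤ℓ = ≤-trans (m≤n*m (suc D) a {{>-nonZero 1≤a}}) (m≤m+n _ β)

  K[1+D]≤Dℓ : K * suc D ≤ D * ℓ
  K[1+D]≤Dℓ = subst (K * suc D ≤_) (sym Dℓ≡) (m≤m+n _ k₂)
    where
    open ≡-Reasoning
    regroup₁ : ∀ D a β → D * (a * suc D + β) ≡ a * D * suc D + β * D
    regroup₁ = solve-∀
    regroup₂ : ∀ a D k r → a * D * suc D + (k * suc D + r) ≡ (a * D + k) * suc D + r
    regroup₂ = solve-∀
    Dℓ≡ : D * ℓ ≡ K * suc D + k₂
    Dℓ≡ = begin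
      D * (a * suc D + β)               ≡⟨ regroup₁ D a β ⟩
      a * D * suc D + β * D             ≡⟨ cong (a * D * suc D +_) βD≡ ⟩
      a * D * suc D + (k₁ * suc D + k₂) ≡⟨ regroup₂ a D k₁ k₂ ⟩
      K * suc D + k₂                    ∎

  0<K : 0 < K
  0<K = <-≤-trans (>-nonZero⁻¹ D) (≤-trans (m≤n*m D a {{>-nonZero 1≤a}}) (m≤m+n _ k₁))

  open WrapAround n≡K+ℓ (s≤s (>-nonZero⁻¹ D)) 1+D≤ℓ K[1+D]≤Dℓ (sym (+-identityʳ _)) z≤n 0<K

wrap-CondII : ∀ {m n a k₁ k₂} → WrapParameters (suc m) n a k₁ k₂ → 2 + m < k₂ → k₂ ≤ 2 * (2 + m) ∸ 2 →
              ∃ λ (S : Collection n (2 + m)) → CondII S a k₁ k₂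
wrap-CondII {m} {n} {a} {k₁} {k₂} record { β = zero ; βD≡ = βD≡ } Δ<k₂ _ =
  contradiction (subst (k₂ ≤_) (sym βD≡) (m≤n+m k₂ _)) (<⇒≱ (≤-<-trans z≤n Δ<k₂))
wrap-CondII {m} {n} {a} {k₁} {k₂}
            record { β = suc β ; 1≤a = 1≤a ; n≡ = n≡ ; βD≡ = βD≡ } Δ<k₂ k₂≤2Δ∸2 =
  S , length≡ , cardC≡K , arcsC≡e , (λ _ → length-Sub+indeg) ,
  (λ v v∉C → let K≤v = ≮⇒≥ (v∉C ∘ <K⇒InC) in ≤-antisym (indeg-L≤ K≤v) (indeg-L≥ refl K≤v))
  where
  D = suc m
  Δ = suc D
  κ = k₂ ∸ Δ
  e = 2 * Δ ∸ 1 ∸ k₂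
  K = a * D + k₁ + 1
  ℓ = a * Δ + β

  k₂≡Δ+κ : k₂ ≡ Δ + κ
  k₂≡Δ+κ = sym (m+[n∸m]≡n (<⇒≤ Δ<k₂))

  e+κ≡D : e + κ ≡ D
  e+κ≡D = +-cancelˡ-≡ Δ _ _ (begin
    Δ + (e + κ) ≡⟨ x∙yz≈y∙xz +-commutativeSemigroup Δ e κ ⟩
    e + (Δ + κ) ≡⟨ cong (e +_) k₂≡Δ+κ ⟨
    e + k₂      ≡⟨ m∸n+n≡m (≤-trans k₂≤2Δ∸2 (n≤1+n _)) ⟩
    2 * Δ ∸ 1   ≡⟨ 2*[1+n]∸1≡1+n+n D ⟩
    Δ + D       ∎)
    where open ≡-Reasoning

  e≤m : e ≤ m
  e≤m = s≤s⁻¹ (subst (suc e ≤_) e+κ≡D (subst (_≤ e + κ) (+-comm e 1) (+-monoʳ-≤ e (m<n⇒0<n∸m Δ<k₂))))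

  n≡K+ℓ : n ≡ K + ℓ
  n≡K+ℓ = trans n≡ (regroup a D k₁ β)
    where
    regroup : ∀ a D k β → a * suc (D + D) + (k + suc β) ≡ a * D + k + 1 + (a * suc D + β)
    regroup = solve-∀

  Δ≤ℓ : Δ ≤ ℓ
  Δ≤ℓ = ≤-trans (m≤n*m Δ a {{>-nonZero 1≤a}}) (m≤m+n _ β)

  KΔ≡Dℓ+e : K * Δ ≡ D * ℓ + e
  KΔ≡Dℓ+e = +-cancelʳ-≡ κ _ _ (begin
    K * Δ + κ                      ≡⟨ regroup₁ a D k₁ κ ⟩
    a * D * Δ + (k₁ * Δ + (Δ + κ)) ≡⟨ cong (λ z → a * D * Δ + (k₁ * Δ + z)) k₂≡Δ+κ ⟨
    a * D * Δ + (k₁ * Δ + k₂)      ≡⟨ cong (a * D * Δ +_) βD≡ ⟨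
    a * D * Δ + suc β * D          ≡⟨ regroup₂ a D β ⟩
    D * ℓ + D                      ≡⟨ cong (D * ℓ +_) e+κ≡D ⟨
    D * ℓ + (e + κ)                ≡⟨ +-assoc (D * ℓ) e κ ⟨
    D * ℓ + e + κ                  ∎)
    where
    open ≡-Reasoning
    regroup₁ : ∀ a D k κ → (a * D + k + 1) * suc D + κ ≡ a * D * suc D + (k * suc D + (suc D + κ))
    regroup₁ = solve-∀
    regroup₂ : ∀ a D β → a * D * suc D + suc β * D ≡ D * (a * suc D + β) + D
    regroup₂ = solve-∀

  e<K : e < K
  e<K = begin-strict
    e          ≤⟨ e≤m ⟩
    m          <⟨ n<1+n m ⟩
    D          ≤⟨ m≤n*m D a {{>-nonZero 1≤a}} ⟩
    a * D      ≤⟨ m≤m+n (a * D) k₁ ⟩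
    a * D + k₁ <⟨ m<m+n (a * D + k₁) z<s ⟩
    K          ∎
    where open ≤-Reasoning

  open WrapAround n≡K+ℓ (s≤s (s≤s z≤n)) Δ≤ℓ ≤-refl KΔ≡Dℓ+e e≤m e<K

  length≡ : length S ≡ a * D * D + k₁ * D + κ
  length≡ = +-cancelʳ-≡ e _ _ (begin
    length S + e                 ≡⟨ cong (_+ e) length-S≡ ⟩
    e * m + (K ∸ e) * D + e      ≡⟨ regroup₁ e m (K ∸ e) ⟩
    (K ∸ e) * D + e * D          ≡⟨ *-distribʳ-+ D (K ∸ e) e ⟨
    (K ∸ e + e) * D              ≡⟨ cong (_* D) (m∸n+n≡m (<⇒≤ e<K)) ⟩
    K * D                        ≡⟨ regroup₂ a D k₁ ⟩
    a * D * D + k₁ * D + D       ≡⟨ cong (a * D * D + k₁ * D +_) (trans (+-comm κ e) e+κ≡D) ⟨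
    a * D * D + k₁ * D + (κ + e) ≡⟨ +-assoc (a * D * D + k₁ * D) κ e ⟨
    a * D * D + k₁ * D + κ + e   ∎)
    where
    open ≡-Reasoning
    regroup₁ : ∀ e m x → e * m + x * suc m + e ≡ x * suc m + e * suc m
    regroup₁ = solve-∀
    regroup₂ : ∀ a D k → (a * D + k + 1) * D ≡ a * D * D + k * D + D
    regroup₂ = solve-∀

circulant-CondIV : ∀ {m n} → 2 + m + 1 ≤ n → n ≤ 2 * (2 + m) ∸ 2 →
                   ∃ λ (S : Collection n (2 + m)) → CondIV S
circulant-CondIV {m} {suc n'} Δ+1≤n n≤2Δ∸2 =
  S , length≡ , (λ _ → cardC≡K) , (λ _ → inj₁ cardC≡K) ,
  (λ u u∈C → trans (cong₂ _+_ (outdegC≡d (InC⇒<K u∈C)) (trans cardL≡n∸K n∸c≡ℓ))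
                   (trans (+-comm d ℓ) (sym Δ≡ℓ+d))) ,
  (λ u u∈C → trans (cong₂ _+_ (length-Sub (InC⇒<K u∈C)) (indeg≡d (InC⇒<K u∈C))) (m∸n+n≡m (<⇒≤ d<1+m))) ,
  (λ s s∈S v v∉C → L⊆leaves s∈S (≮⇒≥ (v∉C ∘ <K⇒InC)))
  where
  Δ = 2 + m
  c = n' / 2
  t = n' % 2
  ℓ = suc (c + t)
  d = Δ ∸ ℓ

  n'≡t+2c : n' ≡ t + c * 2
  n'≡t+2c = m≡m%n+[m/n]*n n' 2

  t≤1 : t ≤ 1
  t≤1 = s≤s⁻¹ (m%n<n n' 2)

  n≡c+ℓ : suc n' ≡ c + ℓ
  n≡c+ℓ = trans (cong suc n'≡t+2c) (regroup t c)
    where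
    regroup : ∀ t c → suc (t + c * 2) ≡ c + suc (c + t)
    regroup = solve-∀

  n∸c≡ℓ : suc n' ∸ c ≡ ℓ
  n∸c≡ℓ = trans (cong (_∸ c) n≡c+ℓ) (m+n∸m≡n c ℓ)

  c≤m : c ≤ m
  c≤m = s≤s⁻¹ (*-cancelʳ-< 2 c (suc m) (begin-strict
    c * 2         ≤⟨ m≤n+m (c * 2) t ⟩
    t + c * 2     ≡⟨ n'≡t+2c ⟨
    n'            <⟨ n≤2Δ∸2 ⟩
    2 * Δ ∸ 2     ≡⟨ 2*[1+n]∸2≡n+n (suc m) ⟩
    suc m + suc m ≡⟨ cong (suc m +_) (+-identityʳ (suc m)) ⟨
    2 * suc m     ≡⟨ *-comm 2 (suc m) ⟩
    suc m * 2     ∎))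
    where open ≤-Reasoning

  ℓ≤Δ : ℓ ≤ Δ
  ℓ≤Δ = s≤s (subst (c + t ≤_) (+-comm m 1) (+-mono-≤ c≤m t≤1))

  Δ≡ℓ+d : Δ ≡ ℓ + d
  Δ≡ℓ+d = sym (m+[n∸m]≡n ℓ≤Δ)

  d<c : d < c
  d<c = +-cancelˡ-< ℓ d c (begin-strict
    ℓ + d  ≡⟨ Δ≡ℓ+d ⟨
    Δ      <⟨ subst (_≤ suc n') (+-comm Δ 1) Δ+1≤n ⟩
    suc n' ≡⟨ n≡c+ℓ ⟩
    c + ℓ  ≡⟨ +-comm c ℓ ⟩
    ℓ + c  ∎)
    where open ≤-Reasoning

  1+m≡c+t+d : suc m ≡ c + t + d
  1+m≡c+t+d = suc-injective Δ≡ℓ+d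

  d<1+m : d < suc m
  d<1+m = subst (d <_) (sym 1+m≡c+t+d) (m<n+m d (<-≤-trans (≤-<-trans z≤n d<c) (m≤m+n c t)))

  open Circulant n≡c+ℓ Δ≡ℓ+d d<c (m<n⇒0<n∸m d<1+m)

  length≡ : length S ≡ n' * n' / 4
  length≡ = begin
    length S                      ≡⟨ length-S≡ ⟩
    c * (suc m ∸ d)               ≡⟨ cong (λ z → c * (z ∸ d)) 1+m≡c+t+d ⟩
    c * (c + t + d ∸ d)           ≡⟨ cong (c *_) (m+n∸n≡m (c + t) d) ⟩
    c * (c + t)                   ≡⟨ [m*n+o]/n≡m (c * (c + t)) (s≤s (≤-trans t≤1 (s≤s z≤n))) ⟨
    (c * (c + t) * 4 + t) / 4     ≡⟨ cong (λ z → (c * (c + t) * 4 + z) / 4) (t*t≡t t≤1) ⟨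
    (c * (c + t) * 4 + t * t) / 4 ≡⟨ cong (_/ 4) (square t c) ⟨
    (t + c * 2) * (t + c * 2) / 4 ≡⟨ cong (λ z → z * z / 4) n'≡t+2c ⟨
    n' * n' / 4                   ∎
    where
    open ≡-Reasoning
    square : ∀ t c → (t + c * 2) * (t + c * 2) ≡ c * (c + t) * 4 + t * t
    square = solve-∀
    t*t≡t : ∀ {t} → t ≤ 1 → t * t ≡ t
    t*t≡t z≤n       = refl
    t*t≡t (s≤s z≤n) = refl

wrap-𝔄 : ∀ {m n a k₁ k₂} → 2 * (2 + m) ∸ 1 ≤ n → k₂ ≤ 2 * (2 + m) ∸ 2 →
         WrapParameters (suc m) n a k₁ k₂ → ∃ λ (S : Collection n (2 + m)) → In𝔄 n (2 + m) a k₁ k₂ S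
wrap-𝔄 {m} {n} {a} {k₁} {k₂} 2Δ∸1≤n k₂≤2Δ∸2 params with 2 + m <? k₂
... | yes Δ<k₂ =
  let S , condII = wrap-CondII params Δ<k₂ k₂≤2Δ∸2 in
  S , (λ _ k₂<Δ → contradiction k₂<Δ (<⇒≯ Δ<k₂)) , (λ _ _ → condII) ,
      (λ _ k₂≡Δ → contradiction k₂≡Δ (>⇒≢ Δ<k₂)) ,
      (λ _ n≤2Δ∸2 → contradiction n≤2Δ∸2 (<⇒≱ 2Δ∸1≤n))
... | no Δ≮k₂ =
  let S , condI = wrap-CondI params in
  S , (λ _ _ → condI) , (λ _ Δ<k₂ → contradiction Δ<k₂ Δ≮k₂) ,
      (λ _ _ → proj₁ condI , inj₁ condI) ,
      (λ _ n≤2Δ∸2 → contradiction n≤2Δ∸2 (<⇒≱ 2Δ∸1≤n))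

circulant-𝔄 : ∀ {m n a k₁ k₂} → 2 + m + 1 ≤ n → ¬ (2 * (2 + m) ∸ 1 ≤ n) →
              ∃ λ (S : Collection n (2 + m)) → In𝔄 n (2 + m) a k₁ k₂ S
circulant-𝔄 Δ+1≤n 2Δ∸1≰n =
  let S , condIV = circulant-CondIV Δ+1≤n (s≤s⁻¹ (≰⇒> 2Δ∸1≰n)) in
  S , (λ 2Δ∸1≤n → contradiction 2Δ∸1≤n 2Δ∸1≰n) , (λ 2Δ∸1≤n → contradiction 2Δ∸1≤n 2Δ∸1≰n) ,
      (λ 2Δ∸1≤n → contradiction 2Δ∸1≤n 2Δ∸1≰n) , (λ _ _ → condIV)

lemma2p3 : (Δ n a b k₁ k₂ : ℕ)
    → 2 ≤ Δ
    → Δ + 1 ≤ n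
    → n ≡ a * (2 * Δ ∸ 1) + b
    → b * (Δ ∸ 1) ≡ k₁ * (2 * Δ ∸ 1) + k₂
    → b ≤ 2 * Δ ∸ 2
    → k₂ ≤ 2 * Δ ∸ 2
    → ∃ λ (S : Collection n Δ) → In𝔄 n Δ a k₁ k₂ S
lemma2p3 (suc (suc m)) n a b k₁ k₂ _ Δ+1≤n n≡ bD≡ b≤2Δ∸2 k₂≤2Δ∸2 with 2 * suc (suc m) ∸ 1 ≤? n
... | yes 2Δ∸1≤n = wrap-𝔄 2Δ∸1≤n k₂≤2Δ∸2 (wrapParameters {a = a} {b} {k₁} 2Δ∸1≤n n≡ bD≡ b≤2Δ∸2)
... | no  2Δ∸1≰n = circulant-𝔄 {a = a} {k₁} {k₂} Δ+1≤n 2Δ∸1≰n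
lemma2p3 (suc zero) _ _ _ _ _ (s≤s ())
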